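{- Let $p$ be a prime and let $V$ be a linear subspace of $\mathbb{F}_p^{n}$. Let $A_1,\dots,A_d$ be a partition of $[n]$ into sets of twins for $V$, and suppose that $V$ is $2$-closed. If $\dim(V) \geq d-h$, then at least $d-2h$ of the numbers $|A_1|,\dots,|A_{d}|$ are divisible by $p$.
   Context: For $v\in\mathbb{F}_p^n$ let $\|v\|=\sum_{j=1}^n v(j)\in\mathbb{F}_p$, and for $v,w\in\mathbb{F}_p^n$ let $v\cdot w$ be the coordinatewise product. $V$ is $2$-closed if $\|v\|=0$ for all $v\in V$ and $\|v\cdot w\|=0$ for all $v,w\in V$. Indices $i,j\in[n]$ are twins for $V$ if $v(i)=v(j)$ for every $v\in V$ and $v(i)\neq0$ for at least one $v\in V$. A set $T\subset[n]$ is a set of twins for $V$ if either $|T|=1$ or any two distinct elements of $T$ are twins for $V$. -}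

module Defs where

open import Data.Nat as ℕ using (ℕ; zero; suc)
open import Data.Nat.Divisibility using (_∣?_)
open import Data.Integer as ℤ using (ℤ; +_; _-_)
open import Data.Integer.Divisibility as ℤD using ()
open import Data.Fin as Fin using (Fin)
open import Data.Fin.Properties using () renaming (_≟_ to _≟ᶠ_)
open import Data.Product using (Σ; ∃; _×_)
open import Relation.Nullary using (¬_; Dec; yes; no)
open import Relation.Binary.PropositionalEquality using (_≡_; _≢_)

-- Elements of F_p are represented by integers, up to congruence mod p.
infix 4 _≈[_]_
_≈[_]_ : ℤ → ℕ → ℤ → Set
a ≈[ p ] b = (+ p) ℤD.∣ (a - b)

-- Vectors in F_p^n : functions Fin n → ℤ (compared pointwise mod p).
Vect : ℕ → Set
Vect n = Fin n → ℤ

Σℤ : ∀ {n} → (Fin n → ℤ) → ℤ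
Σℤ {zero}  f = + 0
Σℤ {suc n} f = f Fin.zero ℤ.+ Σℤ (λ i → f (Fin.suc i))

Σℕ : ∀ {n} → (Fin n → ℕ) → ℕ
Σℕ {zero}  f = 0
Σℕ {suc n} f = f Fin.zero ℕ.+ Σℕ (λ i → f (Fin.suc i))

count : ∀ {n} {P : Fin n → Set} → ((i : Fin n) → Dec (P i)) → ℕ
count P? = Σℕ (λ i → indicator (P? i))
  where
  indicator : ∀ {A : Set} → Dec A → ℕ
  indicator (yes _) = 1
  indicator (no _)  = 0

‖_‖ : ∀ {n} → Vect n → ℤ
‖ v ‖ = Σℤ v

_·_ : ∀ {n} → Vect n → Vect n → Vect n
(v · w) j = v j ℤ.* w j

record Subspace (p n : ℕ) : Set₁ where
  field
    _∈V       : Vect n → Set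
    respects  : ∀ {v w} → (∀ j → v j ≈[ p ] w j) → v ∈V → w ∈V
    zero∈     : (λ _ → + 0) ∈V
    +-closed  : ∀ {v w} → v ∈V → w ∈V → (λ j → v j ℤ.+ w j) ∈V
    *-closed  : ∀ c {v} → v ∈V → (λ j → c ℤ.* v j) ∈V
open Subspace public

lincomb : ∀ {n m} → (Fin m → ℤ) → (Fin m → Vect n) → Vect n
lincomb a b j = Σℤ (λ i → a i ℤ.* b i j)

IsBasis : ∀ {p n m} → Subspace p n → (Fin m → Vect n) → Set
IsBasis {p} {n} {m} V b =
    (∀ i → (V ∈V) (b i))
  × (∀ (a : Fin m → ℤ) → (∀ j → lincomb a b j ≈[ p ] ℤ.0ℤ) → ∀ i → a i ≈[ p ] ℤ.0ℤ)
  × (∀ v → (V ∈V) v → Σ (Fin m → ℤ) λ a → ∀ j → v j ≈[ p ] lincomb a b j)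

-- dim V ≥ k  :  V has a basis of size m, and every basis has size ≥ k
-- (used as: for every basis of V of size m, k ≤ m)

TwoClosed : ∀ {p n} → Subspace p n → Set
TwoClosed {p} V =
    (∀ v → (V ∈V) v → ‖ v ‖ ≈[ p ] ℤ.0ℤ)
  × (∀ v w → (V ∈V) v → (V ∈V) w → ‖ v · w ‖ ≈[ p ] ℤ.0ℤ)

Twins : ∀ {p n} → Subspace p n → Fin n → Fin n → Set
Twins {p} V i j =
    (∀ v → (V ∈V) v → v i ≈[ p ] v j)
  × (∃ λ v → (V ∈V) v × ¬ (v i ≈[ p ] ℤ.0ℤ))

-- A partition of [n] into d parts A_0..A_{d-1}, given by a labelling
-- c : Fin n → Fin d (A_k = c⁻¹(k)), all parts nonempty.
IsPartition : ∀ {n d} → (Fin n → Fin d) → Set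
IsPartition {n} c = ∀ k → ∃ λ i → c i ≡ k

partSize : ∀ {n d} → (Fin n → Fin d) → Fin d → ℕ
partSize c k = count (λ i → c i ≟ᶠ k)

IsTwinSet : ∀ {p n d} → Subspace p n → (Fin n → Fin d) → Fin d → Set
IsTwinSet V c k =
  (partSize c k ≡ 1) ⊎' (∀ i j → c i ≡ k → c j ≡ k → i ≢ j → Twins V i j)
  where
  open import Data.Sum using () renaming (_⊎_ to _⊎'_)

numDivisible : ∀ {n d} → ℕ → (Fin n → Fin d) → ℕ
numDivisible p c = count (λ k → p ∣? partSize c k)

-- Restrict a basis of V to one representative per part. Twins make every vector of V constant
-- on each part, so the restricted vectors w₁ … w_m stay independent in F_p^d, and 2-closedness
-- says exactly that they are pairwise orthogonal for the diagonal form Σ_k |A_k| x_k y_k.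
-- For a diagonal form whose radical has dimension z (the number of k with p ∣ |A_k|), two
-- mutually orthogonal independent families of sizes m and l satisfy m + l ≤ d + z; this is
-- proved by Gaussian elimination one coordinate at a time. Taking both families equal to the
-- restricted basis gives 2m ≤ d + z, and m ≥ d - h yields z ≥ d - 2h.
module Submission where

open import Defs
open import Data.Nat as ℕ using (ℕ; zero; suc; _≤_; _∸_; z≤n; s≤s)
import Data.Nat.Properties as ℕP
import Data.Nat.Divisibility as ℕD
open import Data.Nat.Primality using (Prime; euclidsLemma; prime⇒nonTrivial)
import Data.Nat.Tactic.RingSolver as ℕSolver
open import Data.Integer as ℤ using (ℤ; +_; _+_; _*_; -_; _-_; 0ℤ; 1ℤ)
import Data.Integer.Properties as ℤP
open import Data.Integer.Divisibility.Signed using (_∣_; divides; _∣?_; ∣ᵤ⇒∣; ∣⇒∣ᵤ;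
  ∣m∣n⇒∣m+n; ∣m⇒∣-m; ∣n⇒∣m*n; ∣m⇒∣m*n; ∣m+n∣n⇒∣m; ∣m+n∣m⇒∣n)
open import Data.Integer.Tactic.RingSolver using (solve-∀)
open import Algebra.Properties.Semiring.Sum ℤP.+-*-semiring
  using (sum; sum-syntax; sum-cong-≗; sum-replicate-zero; ∑-distrib-+; ∑-comm; sum-remove;
         *-distribˡ-sum; *-distribʳ-sum)
open import Data.Fin using (Fin; zero; suc; punchIn; _≟_)
open import Data.Fin.Properties using (all?; ¬∀⟶∃¬; punchInᵢ≢i)
open import Data.Fin.Patterns using (0F)
open import Data.Vec.Functional using (Vector; tail; map; insertAt; removeAt)
open import Data.Vec.Functional.Properties using (insertAt-lookup; insertAt-punchIn)
open import Data.List using (_∷_; [])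
open import Data.Product using (_,_; proj₁; proj₂)
open import Data.Sum using (_⊎_; inj₁; inj₂)
open import Function using (_∘_; flip)
open import Relation.Nullary using (¬_; Dec; yes; no; contradiction)
open import Relation.Binary.PropositionalEquality

private
  variable
    m l n d : ℕ

Σℤ≡sum : (f : Fin n → ℤ) → Σℤ f ≡ sum f
Σℤ≡sum {zero}  f = refl
Σℤ≡sum {suc n} f = cong (_+_ (f zero)) (Σℤ≡sum (f ∘ suc))

indicator : ∀ {A : Set} → Dec A → ℕ
indicator (yes _) = 1
indicator (no _)  = 0

indicator-yes : ∀ {A : Set} (A? : Dec A) → A → indicator A? ≡ 1
indicator-yes (yes _) _ = refl
indicator-yes (no ¬a) a = contradiction a ¬a

indicator-no : ∀ {A : Set} (A? : Dec A) → ¬ A → indicator A? ≡ 0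
indicator-no (yes a) ¬a = contradiction a ¬a
indicator-no (no _)  _  = refl

indicator-cong : ∀ {A B : Set} → (A → B) → (B → A) → (A? : Dec A) (B? : Dec B) →
                 indicator A? ≡ indicator B?
indicator-cong A⇒B B⇒A (yes a) B? = sym (indicator-yes B? (A⇒B a))
indicator-cong A⇒B B⇒A (no ¬a) B? = sym (indicator-no B? (¬a ∘ B⇒A))

module _ {P : Fin (suc n) → Set} (P? : ∀ i → Dec (P i)) where

  count-suc : count P? ≡ indicator (P? zero) ℕ.+ count (P? ∘ suc)
  count-suc with P? zero
  ... | yes _ = refl
  ... | no _  = refl

  count-yes : P zero → count P? ≡ suc (count (P? ∘ suc))
  count-yes P₀ = trans count-suc (cong (ℕ._+ count (P? ∘ suc)) (indicator-yes (P? zero) P₀))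

  count-no : ¬ P zero → count P? ≡ count (P? ∘ suc)
  count-no ¬P₀ = trans count-suc (cong (ℕ._+ count (P? ∘ suc)) (indicator-no (P? zero) ¬P₀))

count-cong : ∀ {P Q : Fin n → Set} → (∀ i → P i → Q i) → (∀ i → Q i → P i) →
             (P? : ∀ i → Dec (P i)) (Q? : ∀ i → Dec (Q i)) → count P? ≡ count Q?
count-cong {zero}  P⇒Q Q⇒P P? Q? = refl
count-cong {suc n} P⇒Q Q⇒P P? Q? = begin
  count P?
    ≡⟨ count-suc P? ⟩
  indicator (P? zero) ℕ.+ count (P? ∘ suc)
    ≡⟨ cong₂ ℕ._+_ (indicator-cong (P⇒Q zero) (Q⇒P zero) (P? zero) (Q? zero))
                   (count-cong (P⇒Q ∘ suc) (Q⇒P ∘ suc) (P? ∘ suc) (Q? ∘ suc)) ⟩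
  indicator (Q? zero) ℕ.+ count (Q? ∘ suc)
    ≡⟨ count-suc Q? ⟨
  count Q? ∎
  where open ≡-Reasoning

1≤count : ∀ {P : Fin n → Set} (P? : ∀ i → Dec (P i)) {i} → P i → 1 ≤ count P?
1≤count {suc n} P? {zero}  Pi rewrite count-suc P? | indicator-yes (P? zero) Pi = s≤s z≤n
1≤count {suc n} P? {suc i} Pi rewrite count-suc P? =
  ℕP.≤-trans (1≤count (P? ∘ suc) Pi) (ℕP.m≤n+m _ _)

2≤count : ∀ {P : Fin n → Set} (P? : ∀ i → Dec (P i)) {i j} → i ≢ j → P i → P j → 2 ≤ count P?
2≤count P? {zero}  {zero}  i≢j _  _  = contradiction refl i≢j
2≤count P? {zero}  {suc j} _   Pi Pj rewrite count-suc P? | indicator-yes (P? zero) Pi =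
  s≤s (1≤count (P? ∘ suc) Pj)
2≤count P? {suc i} {zero}  _   Pi Pj rewrite count-suc P? | indicator-yes (P? zero) Pj =
  s≤s (1≤count (P? ∘ suc) Pi)
2≤count P? {suc i} {suc j} i≢j Pi Pj rewrite count-suc P? =
  ℕP.≤-trans (2≤count (P? ∘ suc) (i≢j ∘ cong suc) Pi Pj) (ℕP.m≤n+m _ _)

sum-indicator : (i : Fin d) (g : Fin d → ℤ) → ∑[ k < d ] (+ indicator (i ≟ k) * g k) ≡ g i
sum-indicator {suc d} i g = begin
  ∑[ k < suc d ] (+ indicator (i ≟ k) * g k)
    ≡⟨ sum-remove {i = i} (λ k → + indicator (i ≟ k) * g k) ⟩
  + indicator (i ≟ i) * g i + ∑[ k < d ] (+ indicator (i ≟ punchIn i k) * g (punchIn i k))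
    ≡⟨ cong₂ _+_ (cong (λ t → + t * g i) (indicator-yes (i ≟ i) refl))
                 (sum-cong-≗ λ k → cong (λ t → + t * g (punchIn i k))
                                        (indicator-no (i ≟ punchIn i k) (punchInᵢ≢i i k ∘ sym))) ⟩
  + 1 * g i + ∑[ k < d ] (+ 0 * g (punchIn i k))
    ≡⟨ cong₂ _+_ (ℤP.*-identityˡ (g i))
                 (trans (sum-cong-≗ (ℤP.*-zeroˡ ∘ g ∘ punchIn i)) (sum-replicate-zero d)) ⟩
  g i + 0ℤ
    ≡⟨ ℤP.+-identityʳ (g i) ⟩
  g i ∎
  where open ≡-Reasoning

sum-fiberwise : (c : Fin n → Fin d) (g : Fin d → ℤ) →
                ∑[ x < n ] g (c x) ≡ ∑[ k < d ] (+ partSize c k * g k)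
sum-fiberwise {zero}  {d} c g = sym (trans (sum-cong-≗ (ℤP.*-zeroˡ ∘ g)) (sum-replicate-zero d))
sum-fiberwise {suc n} {d} c g = begin
  g (c zero) + ∑[ x < n ] g (c (suc x))
    ≡⟨ cong₂ _+_ (sym (sum-indicator (c zero) g)) (sum-fiberwise (c ∘ suc) g) ⟩
  ∑[ k < d ] (+ indicator (c zero ≟ k) * g k) + ∑[ k < d ] (+ partSize (c ∘ suc) k * g k)
    ≡⟨ ∑-distrib-+ (λ k → + indicator (c zero ≟ k) * g k) (λ k → + partSize (c ∘ suc) k * g k) ⟨
  ∑[ k < d ] (+ indicator (c zero ≟ k) * g k + + partSize (c ∘ suc) k * g k)
    ≡⟨ sum-cong-≗ split ⟨
  ∑[ k < d ] (+ partSize c k * g k) ∎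
  where
  open ≡-Reasoning
  split : ∀ k → + partSize c k * g k ≡ + indicator (c zero ≟ k) * g k + + partSize (c ∘ suc) k * g k
  split k = begin
    + partSize c k * g k
      ≡⟨ cong (λ t → + t * g k) (count-suc (λ x → c x ≟ k)) ⟩
    + (indicator (c zero ≟ k) ℕ.+ partSize (c ∘ suc) k) * g k
      ≡⟨ cong (_* g k) (ℤP.pos-+ (indicator (c zero ≟ k)) (partSize (c ∘ suc) k)) ⟩
    (+ indicator (c zero ≟ k) + + partSize (c ∘ suc) k) * g k
      ≡⟨ ℤP.*-distribʳ-+ (g k) (+ indicator (c zero ≟ k)) (+ partSize (c ∘ suc) k) ⟩
    + indicator (c zero ≟ k) * g k + + partSize (c ∘ suc) k * g k ∎

m∸2n≤o : ∀ m n k o → m ∸ n ≤ k → k ℕ.+ k ≤ m ℕ.+ o → m ∸ 2 ℕ.* n ≤ o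
m∸2n≤o m n k o m∸n≤k k+k≤m+o = ℕP.m≤n+o⇒m∸n≤o m (2 ℕ.* n) (ℕP.+-cancelˡ-≤ m m _ m+m≤m+2n+o)
  where
  open ℕP.≤-Reasoning
  m≤n+k : m ≤ n ℕ.+ k
  m≤n+k = ℕP.≤-trans (ℕP.m≤n+m∸n m n) (ℕP.+-monoʳ-≤ n m∸n≤k)
  m+m≤m+2n+o : m ℕ.+ m ≤ m ℕ.+ (2 ℕ.* n ℕ.+ o)
  m+m≤m+2n+o = begin
    m ℕ.+ m                         ≤⟨ ℕP.+-mono-≤ m≤n+k m≤n+k ⟩
    (n ℕ.+ k) ℕ.+ (n ℕ.+ k)         ≡⟨ ℕSolver.solve (n ∷ k ∷ []) ⟩
    2 ℕ.* n ℕ.+ (k ℕ.+ k)           ≤⟨ ℕP.+-monoʳ-≤ (2 ℕ.* n) k+k≤m+o ⟩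
    2 ℕ.* n ℕ.+ (m ℕ.+ o)           ≡⟨ ℕSolver.solve (n ∷ m ∷ k ∷ o ∷ []) ⟩
    m ℕ.+ (2 ℕ.* n ℕ.+ o)           ∎

module Fₚ (p : ℕ) (p-prime : Prime p) where

  infix 4 p∣_ _≡ₚ_ _⊥[_]_

  p∣_ : ℤ → Set
  p∣ x = + p ∣ x

  p∣? : ∀ x → Dec (p∣ x)
  p∣? x = + p ∣? x

  _≡ₚ_ : ℤ → ℤ → Set
  x ≡ₚ y = p∣ (x - y)

  p∣0 : p∣ 0ℤ
  p∣0 = divides 0ℤ refl

  p∤1 : ¬ p∣ 1ℤ
  p∤1 p∣1 = ℕ.nonTrivial⇒≢1 {{prime⇒nonTrivial p-prime}} (ℕD.∣1⇒≡1 (∣⇒∣ᵤ p∣1))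

  p∣-product : ∀ x y → p∣ (x * y) → p∣ x ⊎ p∣ y
  p∣-product x y p∣xy
    with euclidsLemma ℤ.∣ x ∣ ℤ.∣ y ∣ p-prime (subst (p ℕD.∣_) (ℤP.abs-* x y) (∣⇒∣ᵤ p∣xy))
  ... | inj₁ p∣x = inj₁ (∣ᵤ⇒∣ p∣x)
  ... | inj₂ p∣y = inj₂ (∣ᵤ⇒∣ p∣y)

  p∣-cancelˡ : ∀ {x y} → ¬ p∣ x → p∣ (x * y) → p∣ y
  p∣-cancelˡ {x} {y} p∤x p∣xy with p∣-product x y p∣xy
  ... | inj₁ p∣x = contradiction p∣x p∤x
  ... | inj₂ p∣y = p∣y

  p∤-product : ∀ {x y} → ¬ p∣ x → ¬ p∣ y → ¬ p∣ (x * y)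
  p∤-product p∤x p∤y = p∤y ∘ p∣-cancelˡ p∤x

  p∣-sum : {f : Fin n → ℤ} → (∀ i → p∣ f i) → p∣ sum f
  p∣-sum {zero}  _    = p∣0
  p∣-sum {suc n} p∣f = ∣m∣n⇒∣m+n (p∣f zero) (p∣-sum (p∣f ∘ suc))

  ≈⇒≡ₚ : ∀ {x y} → x ≈[ p ] y → x ≡ₚ y
  ≈⇒≡ₚ = ∣ᵤ⇒∣

  ≈0⇒p∣ : ∀ {x} → x ≈[ p ] 0ℤ → p∣ x
  ≈0⇒p∣ {x} x≈0 = subst p∣_ (ℤP.+-identityʳ x) (∣ᵤ⇒∣ x≈0)

  p∣⇒≈0 : ∀ {x} → p∣ x → x ≈[ p ] 0ℤ
  p∣⇒≈0 {x} p∣x = ∣⇒∣ᵤ (subst p∣_ (sym (ℤP.+-identityʳ x)) p∣x)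

  ≡ₚ-refl : ∀ {x} → x ≡ₚ x
  ≡ₚ-refl {x} = subst p∣_ (sym (ℤP.+-inverseʳ x)) p∣0

  ≡ₚ-sym : ∀ {x y} → x ≡ₚ y → y ≡ₚ x
  ≡ₚ-sym {x} {y} x≡y = subst p∣_ (negate-difference x y) (∣m⇒∣-m x≡y)
    where
    negate-difference : ∀ x y → - (x - y) ≡ y - x
    negate-difference = solve-∀

  p∣-resp-≡ₚ : ∀ {x y} → x ≡ₚ y → p∣ y → p∣ x
  p∣-resp-≡ₚ {x} {y} x≡y p∣y = subst p∣_ (difference-plus x y) (∣m∣n⇒∣m+n x≡y p∣y)
    where
    difference-plus : ∀ x y → (x - y) + y ≡ x
    difference-plus = solve-∀

  *-congₚ : ∀ {x x′ y y′} → x ≡ₚ x′ → y ≡ₚ y′ → x * y ≡ₚ x′ * y′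
  *-congₚ {x} {x′} {y} {y′} x≡x′ y≡y′ =
    subst p∣_ (sym (product-difference x x′ y y′)) (∣m∣n⇒∣m+n (∣n⇒∣m*n x y≡y′) (∣m⇒∣m*n y′ x≡x′))
    where
    product-difference : ∀ x x′ y y′ → x * y - x′ * y′ ≡ x * (y - y′) + (x - x′) * y′
    product-difference = solve-∀

  sum-congₚ : {f g : Fin n → ℤ} → (∀ i → f i ≡ₚ g i) → sum f ≡ₚ sum g
  sum-congₚ {zero}          _   = p∣0
  sum-congₚ {suc n} {f} {g} f≡g =
    subst p∣_ (sym (sum-difference (f zero) (g zero) (sum (f ∘ suc)) (sum (g ∘ suc))))
              (∣m∣n⇒∣m+n (f≡g zero) (sum-congₚ (f≡g ∘ suc)))
    where
    sum-difference : ∀ x y s t → (x + s) - (y + t) ≡ (x - y) + (s - t)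
    sum-difference = solve-∀

  combination : (Fin m → ℤ) → (Fin m → Vector ℤ d) → Vector ℤ d
  combination {m} a w k = ∑[ i < m ] (a i * w i k)

  Independent : (Fin m → Vector ℤ d) → Set
  Independent w = ∀ a → (∀ k → p∣ combination a w k) → ∀ i → p∣ a i

  ⟨_,_⟩[_] : Vector ℤ d → Vector ℤ d → Vector ℤ d → ℤ
  ⟨_,_⟩[_] {d} x y e = ∑[ k < d ] (e k * (x k * y k))

  _⊥[_]_ : Vector ℤ d → Vector ℤ d → Vector ℤ d → Set
  x ⊥[ e ] y = p∣ ⟨ x , y ⟩[ e ]

  LinearlyClosed : (Vector ℤ d → Set) → Set
  LinearlyClosed P = ∀ α β {x y} → P x → P y → P (λ k → α * x k - β * y k)

  _⊆span_ : (Fin l → Vector ℤ d) → (Fin m → Vector ℤ d) → Set₁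
  _⊆span_ {d = d} u w = ∀ {P : Vector ℤ d → Set} → LinearlyClosed P → (∀ i → P (w i)) → ∀ j → P (u j)

  ⊥-sym : (e x y : Vector ℤ d) → x ⊥[ e ] y → y ⊥[ e ] x
  ⊥-sym e x y = subst p∣_ (sum-cong-≗ λ k → cong (e k *_) (ℤP.*-comm (x k) (y k)))

  ⊥-closedˡ : (e z : Vector ℤ d) → LinearlyClosed (_⊥[ e ] z)
  ⊥-closedˡ {d} e z α β {x} {y} x⊥z y⊥z =
    subst p∣_ expand (∣m∣n⇒∣m+n (∣n⇒∣m*n α x⊥z) (∣n⇒∣m*n (- β) y⊥z))
    where
    open ≡-Reasoning
    distribute : ∀ α β e x y z → α * (e * (x * z)) + (- β) * (e * (y * z)) ≡ e * ((α * x - β * y) * z)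
    distribute = solve-∀
    expand : α * ⟨ x , z ⟩[ e ] + (- β) * ⟨ y , z ⟩[ e ] ≡ ⟨ (λ k → α * x k - β * y k) , z ⟩[ e ]
    expand = begin
      α * ⟨ x , z ⟩[ e ] + (- β) * ⟨ y , z ⟩[ e ]
        ≡⟨ cong₂ _+_ (*-distribˡ-sum α (λ k → e k * (x k * z k)))
                     (*-distribˡ-sum (- β) (λ k → e k * (y k * z k))) ⟩
      ∑[ k < d ] (α * (e k * (x k * z k))) + ∑[ k < d ] ((- β) * (e k * (y k * z k)))
        ≡⟨ ∑-distrib-+ (λ k → α * (e k * (x k * z k))) (λ k → (- β) * (e k * (y k * z k))) ⟨
      ∑[ k < d ] (α * (e k * (x k * z k)) + (- β) * (e k * (y k * z k)))
        ≡⟨ sum-cong-≗ (λ k → distribute α β (e k) (x k) (y k) (z k)) ⟩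
      ⟨ (λ k → α * x k - β * y k) , z ⟩[ e ] ∎

  ⊥-closedʳ : (e z : Vector ℤ d) → LinearlyClosed (z ⊥[ e ]_)
  ⊥-closedʳ e z α β {x} {y} z⊥x z⊥y =
    ⊥-sym e _ z (⊥-closedˡ e z α β (⊥-sym e z x z⊥x) (⊥-sym e z y z⊥y))

  ⊥-combinationʳ : {e x : Vector ℤ d} {u : Fin l → Vector ℤ d} (a : Fin l → ℤ) →
                   (∀ j → x ⊥[ e ] u j) → x ⊥[ e ] combination a u
  ⊥-combinationʳ {d} {l} {e} {x} {u} a x⊥u =
    subst p∣_ (sym expand) (p∣-sum λ j → ∣n⇒∣m*n (a j) (x⊥u j))
    where
    open ≡-Reasoning
    rearrange : ∀ e x a u → (e * x) * (a * u) ≡ a * (e * (x * u))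
    rearrange = solve-∀
    expand : ⟨ x , combination a u ⟩[ e ] ≡ ∑[ j < l ] (a j * ⟨ x , u j ⟩[ e ])
    expand = begin
      ∑[ k < d ] (e k * (x k * combination a u k))
        ≡⟨ sum-cong-≗ (λ k → sym (ℤP.*-assoc (e k) (x k) _)) ⟩
      ∑[ k < d ] ((e k * x k) * combination a u k)
        ≡⟨ sum-cong-≗ (λ k → *-distribˡ-sum (e k * x k) (λ j → a j * u j k)) ⟩
      ∑[ k < d ] ∑[ j < l ] ((e k * x k) * (a j * u j k))
        ≡⟨ sum-cong-≗ (λ k → sum-cong-≗ λ j → rearrange (e k) (x k) (a j) (u j k)) ⟩
      ∑[ k < d ] ∑[ j < l ] (a j * (e k * (x k * u j k)))
        ≡⟨ ∑-comm (λ k j → a j * (e k * (x k * u j k))) ⟩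
      ∑[ j < l ] ∑[ k < d ] (a j * (e k * (x k * u j k)))
        ≡⟨ sum-cong-≗ (λ j → *-distribˡ-sum (a j) (λ k → e k * (x k * u j k))) ⟨
      ∑[ j < l ] (a j * ⟨ x , u j ⟩[ e ]) ∎

  -- The form splits definitionally into the head term and the form on the tails.
  ⊥-tail : (e x y : Vector ℤ (suc d)) → p∣ x 0F → x ⊥[ e ] y → tail x ⊥[ tail e ] tail y
  ⊥-tail e x y p∣x₀ = flip ∣m+n∣m⇒∣n (∣n⇒∣m*n (e 0F) (∣m⇒∣m*n (y 0F) p∣x₀))

  independent-empty : (w : Fin m → Vector ℤ 0) → Independent w → m ≡ 0
  independent-empty {zero}  w _     = refl
  independent-empty {suc m} w indep = contradiction (indep (λ _ → 1ℤ) (λ ()) zero) p∤1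

  independent-tails : {w : Fin m → Vector ℤ (suc d)} → (∀ i → p∣ w i 0F) → Independent w →
                      Independent (map tail w)
  independent-tails heads indep a tails-vanish = indep a λ where
    zero    → p∣-sum λ i → ∣n⇒∣m*n (a i) (heads i)
    (suc k) → tails-vanish k

  -- A vector x with e₀ x₀ ≠ 0 orthogonal to u detects the head of every combination of u.
  independent-tails-⊥ : {e x : Vector ℤ (suc d)} {u : Fin l → Vector ℤ (suc d)} →
                        ¬ p∣ (e 0F * x 0F) → (∀ j → x ⊥[ e ] u j) → Independent u →
                        Independent (map tail u)
  independent-tails-⊥ {e = e} {x} {u} p∤e₀x₀ x⊥u indep a tails-vanish = indep a vanish
    where
    v = combination a u
    head-term : p∣ (e 0F * (x 0F * v 0F))
    head-term = ∣m+n∣n⇒∣m (⊥-combinationʳ {e = e} {x} {u} a x⊥u)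
                          (p∣-sum λ k → ∣n⇒∣m*n (e (suc k)) (∣n⇒∣m*n (x (suc k)) (tails-vanish k)))
    vanish : ∀ k → p∣ v k
    vanish zero    = p∣-cancelˡ p∤e₀x₀ (subst p∣_ (sym (ℤP.*-assoc (e 0F) (x 0F) (v 0F))) head-term)
    vanish (suc k) = tails-vanish k

  -- One step of Gaussian elimination: clear the head coordinate using the pivot w j.
  eliminate : Fin (suc m) → (Fin (suc m) → Vector ℤ (suc d)) → Fin m → Vector ℤ (suc d)
  eliminate j w i k = w j 0F * w (punchIn j i) k - w (punchIn j i) 0F * w j k

  eliminate-head : ∀ j (w : Fin (suc m) → Vector ℤ (suc d)) i → eliminate j w i 0F ≡ 0ℤ
  eliminate-head j w i = cancel (w j 0F) (w (punchIn j i) 0F)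
    where
    cancel : ∀ x y → x * y - y * x ≡ 0ℤ
    cancel = solve-∀

  eliminate⊆span : ∀ j (w : Fin (suc m) → Vector ℤ (suc d)) → eliminate j w ⊆span w
  eliminate⊆span j w closed Pw i = closed (w j 0F) (w (punchIn j i) 0F) (Pw (punchIn j i)) (Pw j)

  eliminate-coefficients : Fin (suc m) → (Fin (suc m) → Vector ℤ (suc d)) → (Fin m → ℤ) →
                           Fin (suc m) → ℤ
  eliminate-coefficients j w a =
    insertAt (λ i → w j 0F * a i) j (combination (λ i → - a i) (removeAt w j) 0F)

  combination-eliminate : ∀ j (w : Fin (suc m) → Vector ℤ (suc d)) (a : Fin m → ℤ) k →
    combination a (eliminate j w) k ≡ combination (eliminate-coefficients j w a) w k
  combination-eliminate {m} j w a k = begin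
    ∑[ i < m ] (a i * eliminate j w i k)
      ≡⟨ sum-cong-≗ (λ i → regroup (a i) (w j 0F) (w (punchIn j i) k) (w (punchIn j i) 0F) (w j k)) ⟩
    ∑[ i < m ] (- a i * w (punchIn j i) 0F * w j k + c * a i * w (punchIn j i) k)
      ≡⟨ ∑-distrib-+ (λ i → - a i * w (punchIn j i) 0F * w j k) (λ i → c * a i * w (punchIn j i) k) ⟩
    ∑[ i < m ] (- a i * w (punchIn j i) 0F * w j k) + ∑[ i < m ] (c * a i * w (punchIn j i) k)
      ≡⟨ cong (_+ ∑[ i < m ] (c * a i * w (punchIn j i) k))
              (*-distribʳ-sum (w j k) (λ i → - a i * w (punchIn j i) 0F)) ⟨
    β * w j k + ∑[ i < m ] (c * a i * w (punchIn j i) k)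
      ≡⟨ cong₂ _+_ (cong (_* w j k) (insertAt-lookup (λ i → c * a i) j β))
                   (sum-cong-≗ λ i → cong (_* w (punchIn j i) k)
                                          (insertAt-punchIn (λ i → c * a i) j β i)) ⟨
    b j * w j k + ∑[ i < m ] (b (punchIn j i) * w (punchIn j i) k)
      ≡⟨ sum-remove {i = j} (λ t → b t * w t k) ⟨
    combination b w k ∎
    where
    open ≡-Reasoning
    c = w j 0F
    β = combination (λ i → - a i) (removeAt w j) 0F
    b = eliminate-coefficients j w a
    regroup : ∀ a c x x₀ y → a * (c * x - x₀ * y) ≡ - a * x₀ * y + c * a * x
    regroup = solve-∀

  independent-eliminate : ∀ j {w : Fin (suc m) → Vector ℤ (suc d)} → ¬ p∣ w j 0F →
                          Independent w → Independent (eliminate j w)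
  independent-eliminate j {w} p∤c indep a vanish i =
    p∣-cancelˡ p∤c (subst p∣_ (insertAt-punchIn (λ i → w j 0F * a i) j _ i)
                          (indep (eliminate-coefficients j w a) vanish′ (punchIn j i)))
    where
    vanish′ : ∀ k → p∣ combination (eliminate-coefficients j w a) w k
    vanish′ k = subst p∣_ (combination-eliminate j w a k) (vanish k)

  data Pivot : (Fin m → Vector ℤ (suc d)) → Set where
    no-pivot : {w : Fin m → Vector ℤ (suc d)} → (∀ i → p∣ w i 0F) → Pivot w
    pivot    : {w : Fin (suc m) → Vector ℤ (suc d)} (j : Fin (suc m)) → ¬ p∣ w j 0F → Pivot w

  pivot? : (w : Fin m → Vector ℤ (suc d)) → Pivot w
  pivot? {zero}  w = no-pivot λ ()
  pivot? {suc m} w with all? (λ i → p∣? (w i 0F))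
  ... | yes heads = no-pivot heads
  ... | no ¬heads = let j , p∤wⱼ₀ = ¬∀⟶∃¬ _ _ (λ i → p∣? (w i 0F)) ¬heads in pivot j p∤wⱼ₀

  record Reduction (w : Fin m → Vector ℤ (suc d)) : Set₁ where
    field
      {size}      : ℕ
      family      : Fin size → Vector ℤ (suc d)
      size-bound  : m ≤ suc size
      heads       : ∀ i → p∣ family i 0F
      independent : Independent family
      spanned     : family ⊆span w

  reduce : {w : Fin m → Vector ℤ (suc d)} → Independent w → Reduction w
  reduce {m} {w = w} indep with pivot? w
  ... | no-pivot heads = record
    { family      = w
    ; size-bound  = ℕP.n≤1+n m
    ; heads       = heads
    ; independent = indep
    ; spanned     = λ _ Pw → Pw
    }
  ... | pivot j p∤wⱼ₀ = record
    { family      = eliminate j w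
    ; size-bound  = ℕP.≤-refl
    ; heads       = λ i → subst p∣_ (sym (eliminate-head j w i)) p∣0
    ; independent = independent-eliminate j {w} p∤wⱼ₀ indep
    ; spanned     = eliminate⊆span j w
    }

  radicalDim : Vector ℤ d → ℕ
  radicalDim e = count (p∣? ∘ e)

  OrthogonalDimBound : ℕ → Set
  OrthogonalDimBound d =
    ∀ {m l} (e : Vector ℤ d) (w : Fin m → Vector ℤ d) (u : Fin l → Vector ℤ d) →
    Independent w → Independent u → (∀ i j → w i ⊥[ e ] u j) → m ℕ.+ l ≤ d ℕ.+ radicalDim e

  -- Induction step on the head coordinate: if p ∣ e₀ the radical grows by one, so both families
  -- may lose a vector; if e₀ is a unit, only a family with a pivot loses one.
  module _ (bound : OrthogonalDimBound d) (e : Vector ℤ (suc d)) where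

    bound-radical-head : {w : Fin m → Vector ℤ (suc d)} {u : Fin l → Vector ℤ (suc d)} →
      p∣ e 0F → Independent w → Independent u → (∀ i j → w i ⊥[ e ] u j) →
      m ℕ.+ l ≤ suc d ℕ.+ radicalDim e
    bound-radical-head {m} {l} {w} {u} p∣e₀ w-indep u-indep w⊥u = begin
      m ℕ.+ l                                ≤⟨ ℕP.+-mono-≤ (size-bound Rw) (size-bound Ru) ⟩
      suc (size Rw) ℕ.+ suc (size Ru)        ≡⟨ cong suc (ℕP.+-suc (size Rw) (size Ru)) ⟩
      suc (suc (size Rw ℕ.+ size Ru))        ≤⟨ s≤s (s≤s tails-bound) ⟩
      suc (suc (d ℕ.+ radicalDim (tail e)))  ≡⟨ cong suc (ℕP.+-suc d _) ⟨
      suc d ℕ.+ suc (radicalDim (tail e))    ≡⟨ cong (suc d ℕ.+_) (count-yes (p∣? ∘ e) p∣e₀) ⟨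
      suc d ℕ.+ radicalDim e                 ∎
      where
      open ℕP.≤-Reasoning
      open Reduction
      Rw = reduce w-indep
      Ru = reduce u-indep
      w′⊥u : ∀ i j → family Rw i ⊥[ e ] u j
      w′⊥u i j = spanned Rw (⊥-closedˡ e (u j)) (λ i′ → w⊥u i′ j) i
      w′⊥u′ : ∀ i j → family Rw i ⊥[ e ] family Ru j
      w′⊥u′ i = spanned Ru (⊥-closedʳ e (family Rw i)) (w′⊥u i)
      tails-bound : size Rw ℕ.+ size Ru ≤ d ℕ.+ radicalDim (tail e)
      tails-bound = bound (tail e) (map tail (family Rw)) (map tail (family Ru))
        (independent-tails (heads Rw) (independent Rw)) (independent-tails (heads Ru) (independent Ru))
        (λ i j → ⊥-tail e (family Rw i) (family Ru j) (heads Rw i) (w′⊥u′ i j))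

    module _ (p∤e₀ : ¬ p∣ e 0F) where

      bound-pivot : {w : Fin (suc m) → Vector ℤ (suc d)} {u : Fin l → Vector ℤ (suc d)} →
        ∀ j → ¬ p∣ w j 0F → Independent w → Independent u → (∀ i j → w i ⊥[ e ] u j) →
        suc m ℕ.+ l ≤ suc d ℕ.+ radicalDim e
      bound-pivot {m} {l} {w} {u} j p∤wⱼ₀ w-indep u-indep w⊥u = begin
        suc (m ℕ.+ l)                      ≤⟨ s≤s tails-bound ⟩
        suc d ℕ.+ radicalDim (tail e)      ≡⟨ cong (suc d ℕ.+_) (count-no (p∣? ∘ e) p∤e₀) ⟨
        suc d ℕ.+ radicalDim e             ∎
        where
        open ℕP.≤-Reasoning
        w′ = eliminate j w
        w′-heads : ∀ i → p∣ w′ i 0F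
        w′-heads i = subst p∣_ (sym (eliminate-head j w i)) p∣0
        w′⊥u : ∀ i t → w′ i ⊥[ e ] u t
        w′⊥u i t = eliminate⊆span j w (⊥-closedˡ e (u t)) (λ i′ → w⊥u i′ t) i
        tails-bound : m ℕ.+ l ≤ d ℕ.+ radicalDim (tail e)
        tails-bound = bound (tail e) (map tail w′) (map tail u)
          (independent-tails w′-heads (independent-eliminate j {w} p∤wⱼ₀ w-indep))
          (independent-tails-⊥ {e = e} {w j} {u} (p∤-product p∤e₀ p∤wⱼ₀) (w⊥u j) u-indep)
          (λ i t → ⊥-tail e (w′ i) (u t) (w′-heads i) (w′⊥u i t))

      bound-unit-head : {w : Fin m → Vector ℤ (suc d)} {u : Fin l → Vector ℤ (suc d)} →
        Independent w → Independent u → (∀ i j → w i ⊥[ e ] u j) →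
        m ℕ.+ l ≤ suc d ℕ.+ radicalDim e
      bound-unit-head {m} {l} {w} {u} w-indep u-indep w⊥u with pivot? w | pivot? u
      ... | pivot j p∤wⱼ₀ | _ = bound-pivot {w = w} {u = u} j p∤wⱼ₀ w-indep u-indep w⊥u
      ... | no-pivot _ | pivot j p∤uⱼ₀ = subst (_≤ suc d ℕ.+ radicalDim e) (ℕP.+-comm l m)
        (bound-pivot {w = u} {u = w} j p∤uⱼ₀ u-indep w-indep (λ i t → ⊥-sym e (w t) (u i) (w⊥u t i)))
      ... | no-pivot w-heads | no-pivot u-heads = begin
        m ℕ.+ l                          ≤⟨ tails-bound ⟩
        d ℕ.+ radicalDim (tail e)        ≤⟨ ℕP.n≤1+n _ ⟩
        suc d ℕ.+ radicalDim (tail e)    ≡⟨ cong (suc d ℕ.+_) (count-no (p∣? ∘ e) p∤e₀) ⟨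
        suc d ℕ.+ radicalDim e           ∎
        where
        open ℕP.≤-Reasoning
        tails-bound : m ℕ.+ l ≤ d ℕ.+ radicalDim (tail e)
        tails-bound = bound (tail e) (map tail w) (map tail u)
          (independent-tails w-heads w-indep) (independent-tails u-heads u-indep)
          (λ i j → ⊥-tail e (w i) (u j) (w-heads i) (w⊥u i j))

  orthogonal-dim-bound : ∀ d → OrthogonalDimBound d
  orthogonal-dim-bound zero e w u w-indep u-indep _
    rewrite independent-empty w w-indep | independent-empty u u-indep = z≤n
  orthogonal-dim-bound (suc d) {m} {l} e w u w-indep u-indep w⊥u = by-head (p∣? (e 0F))
    where
    by-head : Dec (p∣ e 0F) → m ℕ.+ l ≤ suc d ℕ.+ radicalDim e
    by-head (yes p∣e₀) = bound-radical-head (orthogonal-dim-bound d) e p∣e₀ w-indep u-indep w⊥u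
    by-head (no p∤e₀)  = bound-unit-head (orthogonal-dim-bound d) e p∤e₀ w-indep u-indep w⊥u

  module Restriction {n d} (V : Subspace p n) {c : Fin n → Fin d} (partition : IsPartition c)
                     (twin-sets : ∀ k → IsTwinSet V c k) where

    representative : Fin d → Fin n
    representative k = proj₁ (partition k)

    restrict : Vector ℤ n → Vector ℤ d
    restrict v = v ∘ representative

    partSizes : Vector ℤ d
    partSizes k = + partSize c k

    representative-∈ : ∀ k → c (representative k) ≡ k
    representative-∈ k = proj₂ (partition k)

    constant-on-parts : ∀ {v} → (V ∈V) v → ∀ x → v x ≡ₚ restrict v (c x)
    constant-on-parts {v} v∈V x with x ≟ representative (c x)
    ... | yes x≡r = subst (λ r → v x ≡ₚ v r) x≡r (≡ₚ-refl {v x})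
    ... | no x≢r with twin-sets (c x)
    ...   | inj₁ |A|≡1 = contradiction (subst (2 ≤_) |A|≡1 two-elements) λ { (s≤s ()) }
      where two-elements = 2≤count (λ i → c i ≟ c x) x≢r refl (representative-∈ (c x))
    ...   | inj₂ twins =
      ≈⇒≡ₚ {v x} {restrict v (c x)} (proj₁ (twins x _ refl (representative-∈ (c x)) x≢r) v v∈V)

    restriction-independent : {b : Fin m → Vector ℤ n} → IsBasis V b → Independent (map restrict b)
    restriction-independent {b = b} (b∈V , b-indep , _) a restriction-vanishes i =
      ≈0⇒p∣ (b-indep a (λ x → p∣⇒≈0 (lincomb-vanishes x)) i)
      where
      lincomb-vanishes : ∀ x → p∣ lincomb a b x
      lincomb-vanishes x =
        subst p∣_ (sym (Σℤ≡sum (λ i → a i * b i x)))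
              (p∣-resp-≡ₚ (sum-congₚ λ i → *-congₚ {a i} {a i} (≡ₚ-refl {a i})
                                                    (constant-on-parts (b∈V i) x))
                          (restriction-vanishes (c x)))

    restriction-orthogonal : TwoClosed V → ∀ {v w} → (V ∈V) v → (V ∈V) w →
                             restrict v ⊥[ partSizes ] restrict w
    restriction-orthogonal (_ , closed) {v} {w} v∈V w∈V =
      subst p∣_ (sum-fiberwise c (λ k → restrict v k * restrict w k))
            (p∣-resp-≡ₚ restricted≡ₚfull (subst p∣_ (Σℤ≡sum (v · w)) (≈0⇒p∣ (closed v w v∈V w∈V))))
      where
      restricted≡ₚfull : ∑[ x < n ] (restrict v (c x) * restrict w (c x)) ≡ₚ ∑[ x < n ] (v x * w x)
      restricted≡ₚfull = sum-congₚ λ x →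
        ≡ₚ-sym {v x * w x} (*-congₚ {v x} {restrict v (c x)} {w x} {restrict w (c x)}
                                    (constant-on-parts v∈V x) (constant-on-parts w∈V x))

    radicalDim-partSizes : radicalDim partSizes ≡ numDivisible p c
    radicalDim-partSizes =
      count-cong (λ _ → ∣⇒∣ᵤ) (λ _ → ∣ᵤ⇒∣) (p∣? ∘ partSizes) (λ k → p ℕD.∣? partSize c k)

lemma3p5 : (p : ℕ) → Prime p → (n : ℕ) → (V : Subspace p n)
    → (d : ℕ) → (c : Fin n → Fin d) → IsPartition c
    → (∀ k → IsTwinSet V c k)
    → TwoClosed V
    → (h : ℕ) → (m : ℕ) → (b : Fin m → Vect n) → IsBasis V b
    → d ∸ h ≤ m
    → d ∸ 2 ℕ.* h ≤ numDivisible p c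
lemma3p5 p p-prime n V d c partition twin-sets two-closed h m b basis d∸h≤m =
  m∸2n≤o d h m (numDivisible p c) d∸h≤m
         (subst (λ z → m ℕ.+ m ≤ d ℕ.+ z) radicalDim-partSizes 2m≤d+z)
  where
  open Fₚ p p-prime
  open Restriction V partition twin-sets
  w = map restrict b
  w-indep = restriction-independent basis
  2m≤d+z : m ℕ.+ m ≤ d ℕ.+ radicalDim partSizes
  2m≤d+z = orthogonal-dim-bound d partSizes w w w-indep w-indep λ i j →
    restriction-orthogonal two-closed (proj₁ basis i) (proj₁ basis j)
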